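{- Let $\mathbf A$ be a bounded K-lattice. Then there exists at most one element $\mathbf o\in A$ such that $\sim\mathbf o=\mathbf o$ and $\mathbf o\wedge1=0$.
   Context: Write $\sim x:=x\to 1$. A K-lattice is a commutative residuated lattice $(A,\vee,\wedge,\cdot,\to,1)$ (lattice, commutative monoid $(A,\cdot,1)$, $ab\le c$ iff $a\le b\to c$) satisfying $\sim\sim x=x$, the lattice distributive laws whenever at least one of the three elements is $1$, and $xy\wedge 1=(x\wedge1)(y\wedge1)$, $((x\wedge1)\to y)\wedge((\sim y\wedge 1)\to\sim x)=x\to y$. A bounded K-lattice is a K-lattice with an extra constant $0$ satisfying $0\le x$ for all $x$. -}

module Defs where

open import Level using (Level; suc)
open import Relation.Binary.PropositionalEquality using (_≡_)
open import Data.Product using (_×_)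

record BoundedKLattice (a : Level) : Set (suc a) where
  infixr 5 _⇒_
  infixl 7 _·_
  infixr 6 _∨_
  infixr 6 _∧_
  field
    Carrier : Set a
    _∨_ _∧_ _·_ _⇒_ : Carrier → Carrier → Carrier
    𝟙 𝟘 : Carrier

  _≤_ : Carrier → Carrier → Set a
  x ≤ y = x ∧ y ≡ x

  ∼_ : Carrier → Carrier
  ∼ x = x ⇒ 𝟙

  field
    ∨-comm   : ∀ x y → x ∨ y ≡ y ∨ x
    ∧-comm   : ∀ x y → x ∧ y ≡ y ∧ x
    ∨-assoc  : ∀ x y z → (x ∨ y) ∨ z ≡ x ∨ (y ∨ z)
    ∧-assoc  : ∀ x y z → (x ∧ y) ∧ z ≡ x ∧ (y ∧ z)
    ∨-absorbs-∧ : ∀ x y → x ∨ (x ∧ y) ≡ x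
    ∧-absorbs-∨ : ∀ x y → x ∧ (x ∨ y) ≡ x
    ·-comm   : ∀ x y → x · y ≡ y · x
    ·-assoc  : ∀ x y z → (x · y) · z ≡ x · (y · z)
    ·-identityˡ : ∀ x → 𝟙 · x ≡ x
    residuated : ∀ x y z → ((x · y) ≤ z → x ≤ (y ⇒ z)) × (x ≤ (y ⇒ z) → (x · y) ≤ z)
    ∼∼ : ∀ x → ∼ (∼ x) ≡ x
    ∧-distrib-∨-1ˡ : ∀ y z → 𝟙 ∧ (y ∨ z) ≡ (𝟙 ∧ y) ∨ (𝟙 ∧ z)
    ∧-distrib-∨-1ᵐ : ∀ x z → x ∧ (𝟙 ∨ z) ≡ (x ∧ 𝟙) ∨ (x ∧ z)
    ∧-distrib-∨-1ʳ : ∀ x y → x ∧ (y ∨ 𝟙) ≡ (x ∧ y) ∨ (x ∧ 𝟙)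
    ∨-distrib-∧-1ˡ : ∀ y z → 𝟙 ∨ (y ∧ z) ≡ (𝟙 ∨ y) ∧ (𝟙 ∨ z)
    ∨-distrib-∧-1ᵐ : ∀ x z → x ∨ (𝟙 ∧ z) ≡ (x ∨ 𝟙) ∧ (x ∨ z)
    ∨-distrib-∧-1ʳ : ∀ x y → x ∨ (y ∧ 𝟙) ≡ (x ∨ y) ∧ (x ∨ 𝟙)
    ·-∧1 : ∀ x y → (x · y) ∧ 𝟙 ≡ (x ∧ 𝟙) · (y ∧ 𝟙)
    ⇒-split : ∀ x y → ((x ∧ 𝟙) ⇒ y) ∧ (((∼ y) ∧ 𝟙) ⇒ (∼ x)) ≡ x ⇒ y
    𝟘-least : ∀ x → 𝟘 ≤ x

-- If x ∧ 1 = 0 and ∼ y ∧ 1 = 0, the K-lattice axiom splitting x → y turns it into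
-- (0 → y) ∧ (0 → ∼ x), and 0 → z is the top element, so 1 ≤ x → y, i.e. x ≤ y.
-- An element o with ∼ o = o and o ∧ 1 = 0 satisfies both conditions on either side,
-- so any two such elements lie below each other.
module Submission where

open import Defs
open import Level using (Level)
open import Relation.Binary.PropositionalEquality
  using (_≡_; sym; trans; cong; cong₂; subst; module ≡-Reasoning)
open import Data.Product using (proj₁; proj₂)

module BoundedKLatticeProperties {a : Level} (A : BoundedKLattice a) where
  open BoundedKLattice A
  open ≡-Reasoning

  ≤-antisym : ∀ {x y} → x ≤ y → y ≤ x → x ≡ y
  ≤-antisym {x} {y} x≤y y≤x = begin
    x      ≡⟨ sym x≤y ⟩
    x ∧ y  ≡⟨ ∧-comm x y ⟩
    y ∧ x  ≡⟨ y≤x ⟩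
    y      ∎

  𝟘-zeroˡ : ∀ z → 𝟘 · z ≡ 𝟘
  𝟘-zeroˡ z = begin
    𝟘 · z        ≡⟨ sym (proj₂ (residuated 𝟘 z 𝟘) (𝟘-least (z ⇒ 𝟘))) ⟩
    (𝟘 · z) ∧ 𝟘  ≡⟨ ∧-comm (𝟘 · z) 𝟘 ⟩
    𝟘 ∧ (𝟘 · z)  ≡⟨ 𝟘-least (𝟘 · z) ⟩
    𝟘            ∎

  ≤-𝟘⇒ : ∀ z y → z ≤ (𝟘 ⇒ y)
  ≤-𝟘⇒ z y = proj₁ (residuated z 𝟘 y) z𝟘≤y
    where
    z𝟘≡𝟘 : z · 𝟘 ≡ 𝟘
    z𝟘≡𝟘 = trans (·-comm z 𝟘) (𝟘-zeroˡ z)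

    z𝟘≤y : (z · 𝟘) ≤ y
    z𝟘≤y = subst (λ w → w ≤ y) (sym z𝟘≡𝟘) (𝟘-least y)

  𝟙≤⇒-⇒-≤ : ∀ {x y} → 𝟙 ≤ (x ⇒ y) → x ≤ y
  𝟙≤⇒-⇒-≤ {x} {y} 𝟙≤x⇒y =
    subst (λ w → w ≤ y) (·-identityˡ x) (proj₂ (residuated 𝟙 x y) 𝟙≤x⇒y)

  ∧𝟙≡𝟘-⇒-≤ : ∀ {x y} → x ∧ 𝟙 ≡ 𝟘 → ∼ y ∧ 𝟙 ≡ 𝟘 → x ≤ y
  ∧𝟙≡𝟘-⇒-≤ {x} {y} x∧𝟙≡𝟘 ∼y∧𝟙≡𝟘 = 𝟙≤⇒-⇒-≤ 𝟙≤x⇒y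
    where
    x⇒y≡ : x ⇒ y ≡ (𝟘 ⇒ y) ∧ (𝟘 ⇒ ∼ x)
    x⇒y≡ = trans (sym (⇒-split x y))
                 (cong₂ (λ u v → (u ⇒ y) ∧ (v ⇒ ∼ x)) x∧𝟙≡𝟘 ∼y∧𝟙≡𝟘)

    𝟙≤x⇒y : 𝟙 ≤ (x ⇒ y)
    𝟙≤x⇒y = begin
      𝟙 ∧ (x ⇒ y)                     ≡⟨ cong (𝟙 ∧_) x⇒y≡ ⟩
      𝟙 ∧ ((𝟘 ⇒ y) ∧ (𝟘 ⇒ ∼ x))       ≡⟨ sym (∧-assoc 𝟙 (𝟘 ⇒ y) (𝟘 ⇒ ∼ x)) ⟩
      (𝟙 ∧ (𝟘 ⇒ y)) ∧ (𝟘 ⇒ ∼ x)       ≡⟨ cong (_∧ (𝟘 ⇒ ∼ x)) (≤-𝟘⇒ 𝟙 y) ⟩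
      𝟙 ∧ (𝟘 ⇒ ∼ x)                   ≡⟨ ≤-𝟘⇒ 𝟙 (∼ x) ⟩
      𝟙                               ∎

lemma2p2 : {a : Level} (A : BoundedKLattice a) →
    let open BoundedKLattice A in
    (o o′ : Carrier) →
    ∼ o ≡ o → o ∧ 𝟙 ≡ 𝟘 →
    ∼ o′ ≡ o′ → o′ ∧ 𝟙 ≡ 𝟘 →
    o ≡ o′
lemma2p2 A o o′ ∼o≡o o∧𝟙≡𝟘 ∼o′≡o′ o′∧𝟙≡𝟘 = ≤-antisym o≤o′ o′≤o
  where
  open BoundedKLattice A
  open BoundedKLatticeProperties A

  o≤o′ : o ≤ o′
  o≤o′ = ∧𝟙≡𝟘-⇒-≤ o∧𝟙≡𝟘 (trans (cong (_∧ 𝟙) ∼o′≡o′) o′∧𝟙≡𝟘)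

  o′≤o : o′ ≤ o
  o′≤o = ∧𝟙≡𝟘-⇒-≤ o′∧𝟙≡𝟘 (trans (cong (_∧ 𝟙) ∼o≡o) o∧𝟙≡𝟘)
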